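{- Let $G=(V,A)$ be a flow graph with start vertex $s$, let $T$ be a rooted tree with the parent property, and let $G'$ be the derived graph of $G$ with respect to $T$ (itself a flow graph with start vertex $s$). Then $T$ has the sibling property in $G$ if and only if $T$ has the sibling property in $G'$. Equivalently, $T$ is the dominator tree of $G$ if and only if $T$ is the dominator tree of $G'$.
   Context: A flow graph is a finite directed graph $G=(V,A)$ with start vertex $s$ such that every vertex is reachable from $s$; there are no arcs entering $s$. In a flow graph $H$ with start $s$, $v$ dominates $w$ if every path in $H$ from $s$ to $w$ contains $v$; the dominator tree is the tree rooted at $s$ in which $v$ is an ancestor of $w$ iff $v$ dominates $w$. For a rooted tree $T$ with vertex set contained in $V$, $t(v)$ denotes the parent of $v$; ancestors and descendants include the vertex itself. $T$ has the parent property if for every arc $(v,w)\in A$, $t(w)$ is an ancestor of $v$ in $T$. $T$ has the sibling property in a flow graph $H$ if for all siblings $v,w$ in $T$, $v$ does not dominate $w$ in $H$. For an arc $(v,w)\in A$, its derived arc is null if $w$ is an ancestor of $v$ in $T$, and otherwise is $(v',w)$, where $v'=v$ if $v=t(w)$, and otherwise $v'$ is the sibling of $w$ in $T$ that is an ancestor of $v$. The derived graph $G'$ has vertex set $V$ and arc set consisting of all non-null derived arcs of arcs in $A$. -}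

module Defs where

open import Data.Nat using (ℕ; zero; suc)
open import Data.Fin using (Fin)
open import Data.Product using (Σ; ∃; _×_; _,_)
open import Data.Sum using (_⊎_)
open import Relation.Nullary using (¬_)
open import Relation.Binary.PropositionalEquality using (_≡_; _≢_)
open import Function.Bundles using (_⇔_)

Graph : ℕ → Set₁
Graph n = Fin n → Fin n → Set

data Path {n : ℕ} (E : Graph n) : Fin n → Fin n → Set where
  []  : ∀ {u} → Path E u u
  _∷_ : ∀ {u v w} → E u v → Path E v w → Path E u w

data _∈ₚ_ {n : ℕ} {E : Graph n} (x : Fin n) : ∀ {u w} → Path E u w → Set where
  here-[] : x ∈ₚ ([] {u = x})
  here-∷  : ∀ {v w} (e : E x v) (p : Path E v w) → x ∈ₚ (e ∷ p)
  there   : ∀ {u v w} (e : E u v) {p : Path E v w} → x ∈ₚ p → x ∈ₚ (e ∷ p)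

record IsFlowGraph {n : ℕ} (E : Graph n) (s : Fin n) : Set where
  field
    reachable : ∀ v → Path E s v
    no-entry  : ∀ v → ¬ E v s

Dominates : ∀ {n} → Graph n → Fin n → Fin n → Fin n → Set
Dominates E s v w = (p : Path E s w) → v ∈ₚ p

iter : ∀ {A : Set} → (A → A) → ℕ → A → A
iter f zero    x = x
iter f (suc k) x = f (iter f k x)

-- Convention: t s ≡ s (the root has no parent; its value is irrelevant).
-- Every vertex reaches the root by following parents, so there are no cycles.
record IsRootedTree {n : ℕ} (t : Fin n → Fin n) (s : Fin n) : Set where
  field
    root-fixed  : t s ≡ s
    reaches-root : ∀ v → ∃ λ k → iter t k v ≡ s

Ancestor : ∀ {n} → (Fin n → Fin n) → Fin n → Fin n → Set
Ancestor t v w = ∃ λ k → iter t k w ≡ v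

Siblings : ∀ {n} → (Fin n → Fin n) → Fin n → Fin n → Fin n → Set
Siblings t s v w = v ≢ s × w ≢ s × v ≢ w × t v ≡ t w

ParentProperty : ∀ {n} → Graph n → (Fin n → Fin n) → Set
ParentProperty E t = ∀ v w → E v w → Ancestor t (t w) v

SiblingProperty : ∀ {n} → Graph n → Fin n → (Fin n → Fin n) → Set
SiblingProperty E s t = ∀ v w → Siblings t s v w → ¬ Dominates E s v w

IsDerivedArc : ∀ {n} → Fin n → (Fin n → Fin n) → Fin n → Fin n → Fin n → Set
IsDerivedArc s t v w x =
  ¬ Ancestor t w v ×
  ((v ≡ t w × x ≡ v) ⊎ (v ≢ t w × Siblings t s x w × Ancestor t x v))

Derived : ∀ {n} → Graph n → Fin n → (Fin n → Fin n) → Graph n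
Derived E s t x w = Σ (Fin _) λ v → E v w × IsDerivedArc s t v w x

IsDominatorTree : ∀ {n} → Graph n → Fin n → (Fin n → Fin n) → Set
IsDominatorTree E s t = ∀ v w → Ancestor t v w ⇔ Dominates E s v w

module Submission where

-- Parent property: a path enters the subtree of v only through v, so
--   ancestors dominate; with the sibling property dominators are also
--   ancestors (induction on depths).  Hence the sibling property is
--   equivalent to being the dominator tree.
-- Derived graph: G′ has the parent property; E-paths inside a vertex set
--   lift to G′-paths inside it (so G′ is a flow graph, and the sibling
--   property passes from E to G′), and v-avoiding G′-paths into the
--   subtree of t(v) expand to v-avoiding E-paths (so it passes back).

open import Defs
open import Data.Nat using (ℕ; zero; suc; _+_; _*_; _∸_; _≤_; _<_; s≤s; s≤s⁻¹; _≤?_)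
open import Data.Nat.Properties using (+-suc; +-comm; m≤m*n; m∸n+n≡m; ≰⇒>; <⇒≤; ≤-refl)
open import Data.Fin using (Fin; toℕ; fromℕ; fromℕ<)
open import Data.Fin.Properties using (_≟_; any?; toℕ-fromℕ; toℕ-fromℕ<)
open import Data.Product using (Σ; ∃; _×_; _,_; proj₁)
open import Data.Sum using (_⊎_; inj₁; inj₂)
open import Data.Unit using (⊤; tt)
open import Data.Empty using (⊥-elim)
open import Relation.Nullary using (¬_; Dec; yes; no)
open import Relation.Binary.PropositionalEquality using (_≡_; _≢_; refl; sym; trans; cong; subst; module ≡-Reasoning)
open import Function using (_∘_)
open import Function.Bundles using (_⇔_; mk⇔; Equivalence)
open import Function.Construct.Symmetry using (⇔-sym)
open import Function.Construct.Composition using (_⇔-∘_)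

PathAvoiding : ∀ {n} → Graph n → Fin n → Fin n → Fin n → Set
PathAvoiding F x u w = Σ (Path F u w) λ P → ¬ x ∈ₚ P

module _ {n : ℕ} {F : Graph n} where

  _∈?_ : ∀ x {u w} (P : Path F u w) → Dec (x ∈ₚ P)
  x ∈? ([] {u}) with x ≟ u
  ... | yes refl = yes here-[]
  ... | no x≢u = no λ { here-[] → x≢u refl }
  x ∈? (_∷_ {u} e P) with x ≟ u
  ... | yes refl = yes (here-∷ e P)
  ... | no x≢u with x ∈? P
  ...   | yes x∈P = yes (there e x∈P)
  ...   | no x∉P = no λ { (here-∷ _ _) → x≢u refl ; (there _ x∈P) → x∉P x∈P }

  start∈ : ∀ {u w} (P : Path F u w) → u ∈ₚ P
  start∈ [] = here-[]
  start∈ (e ∷ P) = here-∷ e P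

  end∈ : ∀ {u w} (P : Path F u w) → w ∈ₚ P
  end∈ [] = here-[]
  end∈ (e ∷ P) = there e (end∈ P)

  ∉⇒≢ : ∀ {v x u w} {P : Path F u w} → ¬ v ∈ₚ P → x ∈ₚ P → v ≢ x
  ∉⇒≢ {P = P} v∉P x∈P v≡x = v∉P (subst (_∈ₚ P) (sym v≡x) x∈P)

  ∉-[] : ∀ {v z} → v ≢ z → ¬ v ∈ₚ ([] {E = F} {u = z})
  ∉-[] v≢z here-[] = v≢z refl

  ∉-∷ : ∀ {v z z₁ y} {e : F z z₁} {P : Path F z₁ y} → v ≢ z → ¬ v ∈ₚ P → ¬ v ∈ₚ (e ∷ P)
  ∉-∷ v≢z _ (here-∷ _ _) = v≢z refl
  ∉-∷ _ v∉P (there _ v∈P) = v∉P v∈P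

  _++ₚ_ : ∀ {u v w} → Path F u v → Path F v w → Path F u w
  [] ++ₚ Q = Q
  (e ∷ P) ++ₚ Q = e ∷ (P ++ₚ Q)

  ∈-++⁻ : ∀ {x u v w} (P : Path F u v) (Q : Path F v w) → x ∈ₚ (P ++ₚ Q) → x ∈ₚ P ⊎ x ∈ₚ Q
  ∈-++⁻ [] Q x∈Q = inj₂ x∈Q
  ∈-++⁻ (e ∷ P) Q (here-∷ _ _) = inj₁ (here-∷ e P)
  ∈-++⁻ (e ∷ P) Q (there _ x∈PQ) with ∈-++⁻ P Q x∈PQ
  ... | inj₁ x∈P = inj₁ (there e x∈P)
  ... | inj₂ x∈Q = inj₂ x∈Q

  ∉-++ : ∀ {x u v w} {P : Path F u v} {Q : Path F v w} → ¬ x ∈ₚ P → ¬ x ∈ₚ Q → ¬ x ∈ₚ (P ++ₚ Q)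
  ∉-++ {P = P} {Q} x∉P x∉Q x∈PQ with ∈-++⁻ P Q x∈PQ
  ... | inj₁ x∈P = x∉P x∈P
  ... | inj₂ x∈Q = x∉Q x∈Q

  prefix : ∀ {x u w} (P : Path F u w) → x ∈ₚ P →
           Σ (Path F u x) λ Q → ∀ {y} → y ∈ₚ Q → y ∈ₚ P
  prefix [] here-[] = [] , λ y∈[] → y∈[]
  prefix (e ∷ P) (here-∷ _ _) = [] , λ { here-[] → here-∷ e P }
  prefix (e ∷ P) (there _ x∈P) with prefix P x∈P
  ... | Q , Q⊆P = e ∷ Q , λ { (here-∷ _ _) → here-∷ e P ; (there _ y∈Q) → there e (Q⊆P y∈Q) }

  visit-before : ∀ {x u v w} {P : Path F u v} (S : Path F v w) → ¬ x ∈ₚ S → x ∈ₚ (P ++ₚ S) → x ∈ₚ P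
  visit-before {P = P} S x∉S x∈PS with ∈-++⁻ P S x∈PS
  ... | inj₁ x∈P = x∈P
  ... | inj₂ x∈S = ⊥-elim (x∉S x∈S)

  first-visit : ∀ a b {z y} (R : Path F z y) → a ≢ b →
    PathAvoiding F b z a ⊎ PathAvoiding F a z b ⊎ (¬ a ∈ₚ R × ¬ b ∈ₚ R)
  first-visit a b {z} R a≢b with z ≟ a | z ≟ b | R
  ... | yes refl | _ | _ = inj₁ ([] , ∉-[] (a≢b ∘ sym))
  ... | no _ | yes refl | _ = inj₂ (inj₁ ([] , ∉-[] a≢b))
  ... | no z≢a | no z≢b | [] = inj₂ (inj₂ (∉-[] (z≢a ∘ sym) , ∉-[] (z≢b ∘ sym)))
  ... | no z≢a | no z≢b | e ∷ R′ with first-visit a b R′ a≢b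
  ...   | inj₁ (Q , b∉Q) = inj₁ (e ∷ Q , ∉-∷ (z≢b ∘ sym) b∉Q)
  ...   | inj₂ (inj₁ (Q , a∉Q)) = inj₂ (inj₁ (e ∷ Q , ∉-∷ (z≢a ∘ sym) a∉Q))
  ...   | inj₂ (inj₂ (a∉R′ , b∉R′)) = inj₂ (inj₂ (∉-∷ (z≢a ∘ sym) a∉R′ , ∉-∷ (z≢b ∘ sym) b∉R′))

  last-visit : ∀ a b {z y} (R : Path F z y) → a ≢ b →
    PathAvoiding F b a y ⊎ PathAvoiding F a b y ⊎ (¬ a ∈ₚ R × ¬ b ∈ₚ R)
  last-visit a b {z} [] a≢b with z ≟ a | z ≟ b
  ... | yes refl | _ = inj₁ ([] , ∉-[] (a≢b ∘ sym))
  ... | no _ | yes refl = inj₂ (inj₁ ([] , ∉-[] a≢b))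
  ... | no z≢a | no z≢b = inj₂ (inj₂ (∉-[] (z≢a ∘ sym) , ∉-[] (z≢b ∘ sym)))
  last-visit a b {z} (e ∷ R) a≢b with last-visit a b R a≢b
  ... | inj₁ S = inj₁ S
  ... | inj₂ (inj₁ S) = inj₂ (inj₁ S)
  ... | inj₂ (inj₂ (a∉R , b∉R)) with z ≟ a | z ≟ b
  ...   | yes refl | _ = inj₁ (e ∷ R , ∉-∷ (a≢b ∘ sym) b∉R)
  ...   | no _ | yes refl = inj₂ (inj₁ (e ∷ R , ∉-∷ a≢b a∉R))
  ...   | no z≢a | no z≢b = inj₂ (inj₂ (∉-∷ (z≢a ∘ sym) a∉R , ∉-∷ (z≢b ∘ sym) b∉R))

  Along : (Fin n → Set) → ∀ {u w} → Path F u w → Set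
  Along Q P = ∀ {x} → x ∈ₚ P → Q x

  along-snoc : ∀ {Q : Fin n → Set} {u v w} {R : Path F u v} (e : F v w) →
               Along Q R → Q w → Along Q (R ++ₚ (e ∷ []))
  along-snoc {R = R} e QR Qw x∈Re with ∈-++⁻ R (e ∷ []) x∈Re
  ... | inj₁ x∈R = QR x∈R
  ... | inj₂ (here-∷ _ _) = QR (end∈ R)
  ... | inj₂ (there _ here-[]) = Qw

  module _ {s : Fin n} where

    avoiding⇒¬dom : ∀ {v w} → PathAvoiding F v s w → ¬ Dominates F s v w
    avoiding⇒¬dom (P , v∉P) v-dom-w = v∉P (v-dom-w P)

    dom-root : ∀ {v} → Dominates F s v s → v ≡ s
    dom-root d with d []
    ... | here-[] = refl

    -- Domination is transitive: cut a path to w at its visit of v.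
    dom-trans : ∀ {y v w} → Dominates F s y v → Dominates F s v w → Dominates F s y w
    dom-trans y-dom-v v-dom-w P with prefix P (v-dom-w P)
    ... | Q , Q⊆P = Q⊆P (y-dom-v Q)

    -- The dominators of a vertex are linearly ordered: cut a path to w at
    -- its last visit of a or b.
    dom-ordered : (∀ x → Path F s x) → ∀ {a b w} → a ≢ b →
                  Dominates F s a w → Dominates F s b w →
                  Dominates F s a b ⊎ Dominates F s b a
    dom-ordered reach {a} {b} {w} a≢b a-dom-w b-dom-w with last-visit a b (reach w) a≢b
    ... | inj₁ (S , b∉S) = inj₂ λ Q → visit-before S b∉S (b-dom-w (Q ++ₚ S))
    ... | inj₂ (inj₁ (S , a∉S)) = inj₁ λ Q → visit-before S a∉S (a-dom-w (Q ++ₚ S))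
    ... | inj₂ (inj₂ (a∉R , _)) = ⊥-elim (a∉R (a-dom-w (reach w)))

module Tree {n : ℕ} {t : Fin n → Fin n} {s : Fin n} (T : IsRootedTree t s) where
  open IsRootedTree T

  iter-+ : ∀ i j x → iter t (i + j) x ≡ iter t i (iter t j x)
  iter-+ zero j x = refl
  iter-+ (suc i) j x = cong t (iter-+ i j x)

  iter-t : ∀ k x → iter t k (t x) ≡ iter t (suc k) x
  iter-t zero x = refl
  iter-t (suc k) x = cong t (iter-t k x)

  iter-root : ∀ k → iter t k s ≡ s
  iter-root zero = refl
  iter-root (suc k) = trans (cong t (iter-root k)) root-fixed

  iter-beyond : ∀ {K k x} → iter t K x ≡ s → K ≤ k → iter t k x ≡ s
  iter-beyond {K} {k} {x} at-root K≤k = begin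
    iter t k x                  ≡⟨ cong (λ m → iter t m x) (sym (m∸n+n≡m K≤k)) ⟩
    iter t (k ∸ K + K) x        ≡⟨ iter-+ (k ∸ K) K x ⟩
    iter t (k ∸ K) (iter t K x) ≡⟨ cong (iter t (k ∸ K)) at-root ⟩
    iter t (k ∸ K) s            ≡⟨ iter-root (k ∸ K) ⟩
    s                           ∎
    where open ≡-Reasoning

  anc-refl : ∀ x → Ancestor t x x
  anc-refl x = 0 , refl

  anc-parent : ∀ x → Ancestor t (t x) x
  anc-parent x = 1 , refl

  anc-trans : ∀ {a b c} → Ancestor t a b → Ancestor t b c → Ancestor t a c
  anc-trans {a} {b} {c} (i , ib≡a) (j , jc≡b) =
    i + j , trans (iter-+ i j c) (trans (cong (iter t i) jc≡b) ib≡a)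

  anc-root : ∀ {b} → Ancestor t b s → b ≡ s
  anc-root (k , ks≡b) = trans (sym ks≡b) (iter-root k)

  anc-step : ∀ {b y} → Ancestor t b y → b ≢ y → Ancestor t b (t y)
  anc-step (zero , y≡b) b≢y = ⊥-elim (b≢y (sym y≡b))
  anc-step {y = y} (suc k , e) _ = k , trans (iter-t k y) e

  not-anc⇒≢ : ∀ {x v} → ¬ Ancestor t x v → x ≢ v
  not-anc⇒≢ {x} x∌v x≡v = x∌v (subst (Ancestor t x) x≡v (anc-refl x))

  -- Parent steps never cycle back to a non-root vertex: a cycle through x
  -- would be run K ≥ depth(x) times, ending at the root.
  no-cycle : ∀ {x} → x ≢ s → ¬ Ancestor t x (t x)
  no-cycle {x} x≢s (k , back) with reaches-root x
  ... | K , at-root = x≢s (trans (sym (periodic K)) (iter-beyond at-root (m≤m*n K (suc k))))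
    where
      periodic : ∀ m → iter t (m * suc k) x ≡ x
      periodic zero = refl
      periodic (suc m) = trans (iter-+ (suc k) (m * suc k) x)
        (trans (cong (iter t (suc k)) (periodic m)) (trans (sym (iter-t k x)) back))

  sibling-not-anc : ∀ {x y} → Siblings t s x y → ¬ Ancestor t x y
  sibling-not-anc (x≢s , _ , x≢y , tx≡ty) x-anc-y =
    no-cycle x≢s (subst (Ancestor t _) (sym tx≡ty) (anc-step x-anc-y x≢y))

  child-towards : ∀ {p v} → Ancestor t p v → v ≢ p → ∃ λ y → t y ≡ p × y ≢ p × Ancestor t y v
  child-towards (k , e) = from-height k e
    where
      from-height : ∀ {p v} k → iter t k v ≡ p → v ≢ p → ∃ λ y → t y ≡ p × y ≢ p × Ancestor t y v
      from-height zero v≡p v≢p = ⊥-elim (v≢p v≡p)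
      from-height {p} {v} (suc k) e v≢p with iter t k v ≟ p
      ... | yes u≡p = from-height k u≡p v≢p
      ... | no u≢p = iter t k v , e , u≢p , (k , refl)

  child≢root : ∀ {y p} → t y ≡ p → y ≢ p → y ≢ s
  child≢root ty≡p y≢p refl = y≢p (trans (sym root-fixed) ty≡p)

  -- The ancestor relation is decidable: only the first depth(x) parent
  -- steps of x need to be inspected.
  anc? : ∀ y x → Dec (Ancestor t y x)
  anc? y x with reaches-root x
  ... | K , at-root with any? (λ (i : Fin (suc K)) → iter t (toℕ i) x ≟ y)
  ...   | yes (i , e) = yes (toℕ i , e)
  ...   | no none = no λ (k , e) → none (bounded k e)
    where
      bounded : ∀ k → iter t k x ≡ y → ∃ λ (i : Fin (suc K)) → iter t (toℕ i) x ≡ y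
      bounded k e with k ≤? K
      ... | yes k≤K = fromℕ< (s≤s k≤K) , trans (cong (λ m → iter t m x) (toℕ-fromℕ< (s≤s k≤K))) e
      ... | no k≰K = fromℕ K , trans (cong (λ m → iter t m x) (toℕ-fromℕ K))
                                 (trans at-root (trans (sym (iter-beyond at-root (<⇒≤ (≰⇒> k≰K)))) e))

module Subtrees {n : ℕ} {t : Fin n → Fin n} {s : Fin n} (T : IsRootedTree t s)
                {F : Graph n} (pp : ParentProperty F t) where
  open IsRootedTree T
  open Tree T

  -- A path ending in the subtree of v visits v or starts in that subtree:
  -- by the parent property, an arc into the subtree comes from v or from
  -- inside the subtree.
  enter : ∀ {v z y} (P : Path F z y) → Ancestor t v y → v ∈ₚ P ⊎ Ancestor t v z
  enter [] v-anc-y = inj₂ v-anc-y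
  enter {v} (_∷_ {v = z₁} e P) v-anc-y with enter P v-anc-y
  ... | inj₁ v∈P = inj₁ (there e v∈P)
  ... | inj₂ v-anc-z₁ with z₁ ≟ v
  ...   | yes refl = inj₁ (there e (start∈ P))
  ...   | no z₁≢v = inj₂ (anc-trans (anc-step v-anc-z₁ (z₁≢v ∘ sym)) (pp _ _ e))

  anc⇒dom : ∀ {v w} → Ancestor t v w → Dominates F s v w
  anc⇒dom v-anc-w P with enter P v-anc-w
  ... | inj₁ v∈P = v∈P
  ... | inj₂ v-anc-s = subst (_∈ₚ P) (sym (anc-root v-anc-s)) (start∈ P)

  module _ (reach : ∀ x → Path F s x) where

    -- A proper ancestor p of v can be reached without visiting v: cut a
    -- path to p at its first visit of p or v, and v cannot come first.
    avoid-descendant : ∀ {p v} → Ancestor t p v → p ≢ v → PathAvoiding F v s p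
    avoid-descendant {p} {v} p-anc-v p≢v with first-visit p v (reach p) p≢v
    ... | inj₁ to-p = to-p
    ... | inj₂ (inj₁ (Q , p∉Q)) = ⊥-elim (p∉Q (anc⇒dom p-anc-v Q))
    ... | inj₂ (inj₂ (p∉R , _)) = ⊥-elim (p∉R (end∈ (reach p)))

    -- A descendant a of x is reachable from x without visiting any v
    -- outside the subtree of x: take the suffix after the last visit of x.
    within-subtree : ∀ {x a v} → Ancestor t x a → ¬ Ancestor t x v → PathAvoiding F v x a
    within-subtree {x} {a} {v} x-anc-a x∌v with last-visit x v (reach a) (not-anc⇒≢ x∌v)
    ... | inj₁ from-x = from-x
    ... | inj₂ (inj₂ (x∉R , _)) = ⊥-elim (x∉R (anc⇒dom x-anc-a (reach a)))
    ... | inj₂ (inj₁ (S , x∉S)) with enter S x-anc-a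
    ...   | inj₁ x∈S = ⊥-elim (x∉S x∈S)
    ...   | inj₂ x-anc-v = ⊥-elim (x∌v x-anc-v)

    module _ (sp : SiblingProperty F s t) where

      -- The inductive step: if v dominates w, v ∉ {w, t(w)}, then v is
      -- comparable with t(w) as a dominator of w.  If v dom t(w), then
      -- v anc t(w).  If t(w) dom v, then t(w) anc v, and the child y of t(w)
      -- above v is either w (so v, a proper descendant of w, cannot dominate
      -- w) or a sibling of w dominating w (against the sibling property).
      dom⇒anc-step : ∀ {v w} → (Dominates F s v (t w) → Ancestor t v (t w)) →
                     (Dominates F s (t w) v → Ancestor t (t w) v) →
                     Dominates F s v w → Ancestor t v w
      dom⇒anc-step {v} {w} ih-v-p ih-p-v v-dom-w with v ≟ w | v ≟ t w
      ... | yes refl | _ = anc-refl v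
      ... | no _ | yes refl = anc-parent w
      ... | no v≢w | no v≢p with dom-ordered reach v≢p v-dom-w (anc⇒dom (anc-parent w))
      ...   | inj₁ v-dom-p = anc-trans (ih-v-p v-dom-p) (anc-parent w)
      ...   | inj₂ p-dom-v with child-towards (ih-p-v p-dom-v) v≢p
      ...     | y , ty≡p , y≢p , y-anc-v with y ≟ w
      ...       | yes refl = ⊥-elim (avoiding⇒¬dom (avoid-descendant y-anc-v (v≢w ∘ sym)) v-dom-w)
      ...       | no y≢w = ⊥-elim (sp y w (child≢root ty≡p y≢p , w≢s , y≢w , ty≡p)
                                           (dom-trans (anc⇒dom y-anc-v) v-dom-w))
        where
          w≢s : w ≢ s
          w≢s w≡s = v≢w (trans (dom-root (subst (Dominates F s v) w≡s v-dom-w)) (sym w≡s))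

      -- Dominators are ancestors, by induction on a bound m for
      -- depth(v) + depth(w), where kv, kw are depths of v, w.
      dom⇒anc-bounded : ∀ m {v w kv kw} → kv + kw < m → iter t kv v ≡ s → iter t kw w ≡ s →
                        Dominates F s v w → Ancestor t v w
      dom⇒anc-bounded zero () _ _
      dom⇒anc-bounded (suc m) {v} {kw = zero} _ _ refl v-dom-s =
        subst (λ u → Ancestor t u s) (sym (dom-root v-dom-s)) (anc-refl s)
      dom⇒anc-bounded (suc m) {v} {w} {kv} {suc kw} lt v-depth w-depth =
        dom⇒anc-step (dom⇒anc-bounded m {kv = kv} {kw} lt-v-p v-depth p-depth)
                     (dom⇒anc-bounded m {kv = kw} {kv} lt-p-v p-depth v-depth)
        where
          lt-v-p : kv + kw < m
          lt-v-p = subst (_≤ m) (+-suc kv kw) (s≤s⁻¹ lt)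
          lt-p-v : kw + kv < m
          lt-p-v = subst (_< m) (+-comm kv kw) lt-v-p
          p-depth : iter t kw (t w) ≡ s
          p-depth = trans (iter-t kw w) w-depth

      dom⇒anc : ∀ {v w} → Dominates F s v w → Ancestor t v w
      dom⇒anc {v} {w} v-dom-w with reaches-root v | reaches-root w
      ... | kv , v-depth | kw , w-depth = dom⇒anc-bounded (suc (kv + kw)) {kv = kv} {kw} ≤-refl v-depth w-depth v-dom-w

  sibling⇔dominator-tree : IsFlowGraph F s → SiblingProperty F s t ⇔ IsDominatorTree F s t
  sibling⇔dominator-tree fg =
    mk⇔ (λ sp v w → mk⇔ anc⇒dom (dom⇒anc (IsFlowGraph.reachable fg) sp))
        (λ dt v w sib v-dom-w → sibling-not-anc sib (Equivalence.from (dt v w) v-dom-w))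

module DerivedGraph {n : ℕ} {E : Graph n} {s : Fin n} {t : Fin n → Fin n}
                    (fg : IsFlowGraph E s) (T : IsRootedTree t s) (pp : ParentProperty E t) where
  open IsFlowGraph fg
  open Tree T
  open Subtrees T pp

  G′ : Graph n
  G′ = Derived E s t

  -- A derived arc (x, w) has x = t(w) or x a sibling of w, so G′ again has
  -- the parent property.
  derived-parent-property : ParentProperty G′ t
  derived-parent-property x w (_ , _ , _ , inj₁ (v≡tw , x≡v)) = 0 , trans x≡v v≡tw
  derived-parent-property x w (_ , _ , _ , inj₂ (_ , (_ , _ , _ , tx≡tw) , _)) = 1 , tx≡tw

  derived-arc : ∀ {x y} → E x y → ¬ Ancestor t y x → ∃ λ z → G′ z y × Ancestor t z x
  derived-arc {x} {y} e y∌x with x ≟ t y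
  ... | yes x≡ty = x , (x , e , y∌x , inj₁ (x≡ty , refl)) , anc-refl x
  ... | no x≢ty with child-towards (pp _ _ e) x≢ty
  ...   | z , tz≡ty , z≢ty , z-anc-x =
          z , (x , e , y∌x , inj₂ (x≢ty , (child≢root tz≡ty z≢ty , y≢s , z≢y , tz≡ty) , z-anc-x)) , z-anc-x
    where
      y≢s : y ≢ s
      y≢s y≡s = no-entry x (subst (E x) y≡s e)
      z≢y : z ≢ y
      z≢y z≡y = y∌x (subst (λ u → Ancestor t u x) z≡y z-anc-x)

  LiftedPath : (Fin n → Set) → Fin n → Set
  LiftedPath Q b = Σ (Path G′ s b) (Along Q)

  -- Walking along an E-path inside Q, every ancestor of the current vertex
  -- keeps a G′-path from s inside Q: an ancestor of y other than y is an
  -- ancestor of the previous vertex x, and y itself is reached by the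
  -- derived arc of (x, y) unless it is already an ancestor of x.
  lift-from : ∀ {Q : Fin n → Set} {x u} (P : Path E x u) → Along Q P →
              (∀ b → Ancestor t b x → LiftedPath Q b) → ∀ b → Ancestor t b u → LiftedPath Q b
  lift-from [] _ lifted-x = lifted-x
  lift-from {Q} {x} (_∷_ {v = y} e P) Q-eP lifted-x = lift-from P (Q-eP ∘ there e) lifted-y
    where
      Qy : Q y
      Qy = Q-eP (there e (start∈ P))
      lifted-y : ∀ b → Ancestor t b y → LiftedPath Q b
      lifted-y b b-anc-y with b ≟ y
      ... | no b≢y = lifted-x b (anc-trans (anc-step b-anc-y b≢y) (pp _ _ e))
      ... | yes refl with anc? b x
      ...   | yes b-anc-x = lifted-x b b-anc-x
      ...   | no b∌x with derived-arc e b∌x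
      ...     | z , d , z-anc-x with lifted-x z z-anc-x
      ...       | R , Q-R = R ++ₚ (d ∷ []) , along-snoc d Q-R Qy

  lift : ∀ {Q : Fin n → Set} {u} (P : Path E s u) → Along Q P → LiftedPath Q u
  lift {Q} {u} P Q-P = lift-from P Q-P lifted-s u (anc-refl u)
    where
      lifted-s : ∀ b → Ancestor t b s → LiftedPath Q b
      lifted-s b b-anc-s rewrite anc-root b-anc-s = [] , λ { here-[] → Q-P (start∈ P) }

  derived-flow-graph : IsFlowGraph G′ s
  derived-flow-graph = record
    { reachable = λ v → proj₁ (lift {Q = λ _ → ⊤} (reachable v) (λ _ → tt))
    ; no-entry  = λ v → λ { (x , e , _) → no-entry x e }
    }

  -- Sibling property in E implies it in G′: a v-avoiding E-path to w lifts
  -- to a v-avoiding G′-path.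
  sibling-to-derived : SiblingProperty E s t → SiblingProperty G′ s t
  sibling-to-derived sp v w sib v-dom′-w = sp v w sib v-dom-w
    where
      v-dom-w : Dominates E s v w
      v-dom-w P with v ∈? P
      ... | yes v∈P = v∈P
      ... | no v∉P with lift {Q = _≢ v} P (λ x∈P x≡v → v∉P (subst (_∈ₚ P) x≡v x∈P))
      ...   | R , R≢v = ⊥-elim (R≢v (v-dom′-w R) refl)

  -- Let v, w be siblings with
  -- parent p and suppose v dominates w in E.  A v-avoiding G′-path to w
  -- yields a v-avoiding E-path to w: reach p avoiding its child v, then
  -- expand each later arc of the G′-path inside the subtree of p.
  derived-to-sibling : SiblingProperty G′ s t → SiblingProperty E s t
  derived-to-sibling sp′ v w sib@(v≢s , _ , _ , tv≡tw) v-dom-w = sp′ v w sib v-dom′-w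
    where
      p : Fin n
      p = t w

      p-anc-v : Ancestor t p v
      p-anc-v = 1 , tv≡tw

      p≢v : p ≢ v
      p≢v p≡v = no-cycle v≢s (subst (λ q → Ancestor t q (t v)) (trans tv≡tw p≡v) (anc-refl (t v)))

      sibling-below-p : ∀ {x y} → Siblings t s x y → Ancestor t p y → v ≢ x → ¬ Ancestor t x v
      sibling-below-p sib′ p-anc-y v≢x x-anc-v =
        sibling-not-anc sib′ (anc-trans (subst (Ancestor t _) tv≡tw (anc-step x-anc-v (v≢x ∘ sym))) p-anc-y)

      -- A G′-arc (x, y) into the subtree of p, with v ∉ {x, y}, expands to a
      -- v-avoiding E-path: the arc itself, or a path inside the subtree of
      -- the sibling x followed by the original arc.
      expand : ∀ {x y} → G′ x y → Ancestor t p y → v ≢ x → v ≢ y → PathAvoiding E v x y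
      expand (_ , e , _ , inj₁ (_ , refl)) _ v≢x v≢y = e ∷ [] , ∉-∷ v≢x (∉-[] v≢y)
      expand (a , e , _ , inj₂ (_ , sib′ , x-anc-a)) p-anc-y v≢x v≢y
        with within-subtree reachable x-anc-a (sibling-below-p sib′ p-anc-y v≢x)
      ... | S , v∉S = S ++ₚ (e ∷ []) , ∉-++ v∉S (∉-∷ (∉⇒≢ v∉S (end∈ S)) (∉-[] v≢y))

      lower : ∀ {x u} (R : Path G′ x u) → ¬ v ∈ₚ R →
              (Ancestor t p x → PathAvoiding E v s x) → Ancestor t p u → PathAvoiding E v s u
      lower [] _ lowered-x = lowered-x
      lower {x} (_∷_ {v = y} d R) v∉dR lowered-x = lower R (v∉dR ∘ there d) lowered-y
        where
          lowered-y : Ancestor t p y → PathAvoiding E v s y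
          lowered-y p-anc-y with y ≟ p
          ... | yes refl = avoid-descendant reachable p-anc-v p≢v
          ... | no y≢p with lowered-x (anc-trans (anc-step p-anc-y (y≢p ∘ sym)) (derived-parent-property x y d))
                          | expand d p-anc-y (∉⇒≢ v∉dR (start∈ (d ∷ R))) (∉⇒≢ v∉dR (there d (start∈ R)))
          ...   | P , v∉P | S , v∉S = P ++ₚ S , ∉-++ v∉P v∉S

      v-dom′-w : Dominates G′ s v w
      v-dom′-w R with v ∈? R
      ... | yes v∈R = v∈R
      ... | no v∉R = ⊥-elim (avoiding⇒¬dom (lower R v∉R (λ _ → [] , ∉-[] v≢s) (anc-parent w)) v-dom-w)

lemma16 : ∀ {n : ℕ} (E : Graph n) (s : Fin n) (t : Fin n → Fin n)
    → IsFlowGraph E s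
    → IsRootedTree t s
    → ParentProperty E t
    → (SiblingProperty E s t ⇔ SiblingProperty (Derived E s t) s t)
    × (IsDominatorTree E s t ⇔ IsDominatorTree (Derived E s t) s t)
lemma16 E s t fg T pp = siblings , dominator-trees
  where
    open DerivedGraph fg T pp

    siblings : SiblingProperty E s t ⇔ SiblingProperty G′ s t
    siblings = mk⇔ sibling-to-derived derived-to-sibling

    in-E : SiblingProperty E s t ⇔ IsDominatorTree E s t
    in-E = Subtrees.sibling⇔dominator-tree T pp fg

    in-G′ : SiblingProperty G′ s t ⇔ IsDominatorTree G′ s t
    in-G′ = Subtrees.sibling⇔dominator-tree T derived-parent-property derived-flow-graph

    dominator-trees : IsDominatorTree E s t ⇔ IsDominatorTree G′ s t
    dominator-trees = in-G′ ⇔-∘ (siblings ⇔-∘ ⇔-sym in-E)
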